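{- For all integers $n > k \geq 1$, there is an acyclic matching $M$ on the face poset of $C_{n,k}$ (including the empty face) all of whose critical cells (if there are any) have dimension $n-k$.
   Context: Let $[n]=\{1,\dots,n\}$. A partial surjective function $\eta:[n]\to[k]$ is a surjective function from a subset of $[n]$ onto $[k]$; equivalently a $k$-tuple $X=(X_1,\dots,X_k)$ of pairwise disjoint nonempty subsets of $[n]$ with $X_j=\eta^{ -1}(j)$. The polyhedral complex $C_{n,k}$ has one cell $\Delta_\eta=\Delta_{X_1}\times\cdots\times\Delta_{X_k}$ (a product of simplices, $\Delta_S$ the simplex on vertex set $S$) for each such $\eta$, of dimension $\sum_{j=1}^k(|X_j|-1)$; its face poset orders cells by inclusion, i.e. $(X_1,\dots,X_k)\preceq(Y_1,\dots,Y_k)$ iff $X_j\subseteq Y_j$ for all $j$, and we adjoin a unique minimal empty face (denoted $(\emptyset,\dots,\emptyset)$). A matching on a poset $P$ is a set of pairs $\{a_i,b_i\}$, $i=1,\dots,t$, with all elements distinct and each $a_i$ covered by $b_i$ (an immediate predecessor of $b_i$). It is cyclic if there are distinct indices $i_1,\dots,i_s$ ($s\ge 2$) with $a_{i_2}\prec b_{i_1}, a_{i_3}\prec b_{i_2},\dots,a_{i_s}\prec b_{i_{s-1}}, a_{i_1}\prec b_{i_s}$, and acyclic otherwise. The critical cells of a matching are the unmatched elements of the poset. -}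

module Defs where

open import Data.Nat as ℕ using (ℕ; zero; suc)
open import Data.Integer as ℤ using (ℤ; +_; -[1+_])
open import Data.Fin using (Fin; zero; suc; fromℕ; inject₁)
open import Data.Fin.Properties using () renaming (_≟_ to _≟ᶠ_)
open import Data.Maybe using (Maybe; just; nothing)
open import Data.Maybe.Properties using (≡-dec)
open import Data.Vec using (Vec; lookup; count; tabulate)
open import Data.List using (List; []; _∷_; length; concatMap; foldr; allFin; map)
open import Data.List.Relation.Unary.Unique.Propositional using (Unique)
open import Data.Product using (Σ; ∃; _×_; _,_; proj₁; proj₂)
open import Data.Sum using (_⊎_)
open import Data.Bool using (Bool; true; false; _∧_; if_then_else_)
open import Function.Definitions using (Injective)
open import Relation.Binary.PropositionalEquality using (_≡_)
open import Relation.Nullary using (¬_)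

-- A cell of C_{n,k}, or the empty face, is encoded by a partial function
-- η : [n] ⇀ [k], i.e. a vector v of length n with v[i] = just j iff i ∈ X_j.
Pre : ℕ → ℕ → Set
Pre n k = Vec (Maybe (Fin k)) n

IsFace : {n k : ℕ} → Pre n k → Set
IsFace {n} {k} v = (∀ (j : Fin k) → ∃ λ (i : Fin n) → lookup v i ≡ just j)
                 ⊎ (∀ (i : Fin n) → lookup v i ≡ nothing)

_⪯_ : {n k : ℕ} → Pre n k → Pre n k → Set
_⪯_ {n} {k} u v = ∀ (i : Fin n) (j : Fin k) → lookup u i ≡ just j → lookup v i ≡ just j

_≺_ : {n k : ℕ} → Pre n k → Pre n k → Set
u ≺ v = (u ⪯ v) × ¬ (u ≡ v)

_⋖_ : {n k : ℕ} → Pre n k → Pre n k → Set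
_⋖_ {n} {k} u v = (u ≺ v) × ¬ (Σ (Pre n k) λ c → IsFace c × (u ≺ c) × (c ≺ v))

blockSize : {n k : ℕ} → Pre n k → Fin k → ℕ
blockSize v j = count (λ x → ≡-dec _≟ᶠ_ x (just j)) v

isEmptyFace : {n k : ℕ} → Pre n k → Bool
isEmptyFace Vec.[] = true
isEmptyFace (just _ Vec.∷ v) = false
isEmptyFace (nothing Vec.∷ v) = isEmptyFace v

sumℤ : List ℤ → ℤ
sumℤ = foldr ℤ._+_ (+ 0)

dim : {n k : ℕ} → Pre n k → ℤ
dim {n} {k} v = if isEmptyFace v then -[1+ 0 ]
                else sumℤ (map (λ j → (+ blockSize v j) ℤ.- (+ 1)) (allFin k))

Matching : ℕ → ℕ → Set
Matching n k = List (Pre n k × Pre n k)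

elems : {n k : ℕ} → Matching n k → List (Pre n k)
elems = concatMap (λ p → proj₁ p ∷ proj₂ p ∷ [])

IsMatching : {n k : ℕ} → Matching n k → Set
IsMatching M = Unique (elems M)
  × (∀ (i : Fin (length M)) →
       IsFace (proj₁ (Data.List.lookup M i)) × IsFace (proj₂ (Data.List.lookup M i))
       × (proj₁ (Data.List.lookup M i) ⋖ proj₂ (Data.List.lookup M i)))

cnext : {m : ℕ} → Fin (suc m) → Fin (suc m)
cnext {zero} zero = zero
cnext {suc m} zero = suc zero
cnext {suc m} (suc r) with cnext {m} r
... | zero = zero
... | suc r' = suc (suc r')

-- cyclic: distinct indices i_1..i_s (s ≥ 2), a_{i_{r+1}} ≺ b_{i_r}, a_{i_1} ≺ b_{i_s}
IsCyclic : {n k : ℕ} → Matching n k → Set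
IsCyclic M = Σ ℕ λ m → Σ (Fin (suc (suc m)) → Fin (length M)) λ σ →
  Injective _≡_ _≡_ σ ×
  (∀ r → proj₁ (Data.List.lookup M (σ (cnext r))) ≺ proj₂ (Data.List.lookup M (σ r)))

IsAcyclic : {n k : ℕ} → Matching n k → Set
IsAcyclic M = ¬ IsCyclic M

IsCritical : {n k : ℕ} → Matching n k → Pre n k → Set
IsCritical M v = IsFace v × ¬ (Data.List.Membership.Propositional._∈_ v (elems M))
  where import Data.List.Membership.Propositional

-- Write a cell as a word over {∅} ∪ [k] of length n taking every value.  A
-- left-to-right scan selects at most one entry (i , e) to toggle: while the prefix
-- is the diagonal 0, 1, 2, … the scan inserts the next diagonal value at an empty
-- position, or deletes it where it recurs later; once a value c occurs off the
-- diagonal, the first later position that is empty or holds c toggles c.  Toggling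
-- (i , e) does not change what the scan selects, so the toggle pairs a cell with a
-- hole at i with the cell carrying e there, a covering relation; the empty face is
-- paired with the diagonal vertex.  A cell the scan leaves alone is the vertex or
-- has no empty position, hence dimension n - k.  For acyclicity, every cell u ≠ a
-- below the partner of a has smaller potential than a: first compare sizes, then
-- read the words in base 3 with the scan's ranks (value to insert < empty < other).

module Submission where

open import Defs
open import Data.Nat as ℕ using (ℕ; zero; suc; _+_; _*_; _^_; _∸_; _≤_; _<_; z≤n; s≤s)
import Data.Nat.Properties as ℕ
open import Data.Integer as ℤ using (+_)
import Data.Integer.Properties as ℤ
open import Data.Integer.Tactic.RingSolver using (solve-∀)
open import Data.Bool using (true; false; if_then_else_)
open import Data.Fin as Fin using (Fin; zero; suc; toℕ; _≟_)
import Data.Fin.Properties as Fin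
open import Data.Maybe as Maybe using (Maybe; just; nothing)
open import Data.Maybe.Properties using (≡-dec)
open import Data.Vec as Vec using (Vec; []; _∷_; lookup; _[_]≔_; replicate)
import Data.Vec.Properties as Vec
open import Data.Vec.Properties using ([]≔-idempotent; []≔-lookup; lookup∘update; lookup-replicate)
open import Data.Vec.Membership.Propositional.Properties using () renaming (∈-lookup to ∈ᵥ-lookup)
import Data.Vec.Relation.Unary.Any as Any
open import Data.Vec.Relation.Unary.Any using (here; there; toSum)
open import Data.Vec.Relation.Unary.Any.Properties using (lookup-index)
open import Data.Vec.Relation.Binary.Pointwise.Inductive as Pointwise using (Pointwise; []; _∷_)
open import Data.List as List
  using (List; []; _∷_; map; filter; deduplicate; cartesianProductWith; allFin)
import Data.List.Properties as List
open import Data.List.Extrema.Nat using (argmin; f[argmin]≤f[xs])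
open import Data.List.Membership.Propositional using (_∈_)
open import Data.List.Membership.Propositional.Properties
  using ( ∈-map⁺; ∈-map⁻; ∈-filter⁺; ∈-filter⁻; ∈-deduplicate⁺; ∈-cartesianProductWith⁺
        ; ∈-allFin; ∈-lookup)
open import Data.List.Relation.Unary.All as All using ([]; _∷_)
open import Data.List.Relation.Unary.AllPairs using ([]; _∷_)
open import Data.List.Relation.Unary.Any using (here; there)
open import Data.List.Relation.Unary.Unique.Propositional using (Unique)
import Data.List.Relation.Unary.Unique.Propositional.Properties as Unique
open import Data.List.Relation.Unary.Unique.DecPropositional.Properties using (deduplicate-!)
open import Algebra.Properties.CommutativeMonoid.Sum ℕ.+-0-commutativeMonoid
  using (sum; sum-replicate-zero; sum-cong-≗; ∑-distrib-+)
open import Data.Product as Product using (Σ; ∃; _×_; _,_; proj₁; proj₂)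
open import Data.Sum as Sum using (_⊎_; inj₁; inj₂)
open import Data.Unit using (⊤; tt)
open import Data.Empty using (⊥)
open import Function using (_∘_; case_of_)
open import Relation.Binary.Definitions using (tri<; tri≈; tri>)
open import Relation.Nullary using (¬_; Dec; does; yes; no; contradiction)
open import Relation.Unary using (Decidable)
open import Relation.Binary.PropositionalEquality
  using (_≡_; _≢_; refl; sym; trans; cong; cong₂; subst; module ≡-Reasoning)

cnext-irreflexive : ∀ {m} (r : Fin (suc (suc m))) → cnext r ≢ r
cnext-irreflexive zero ()
cnext-irreflexive {m} (suc r) eq with cnext {m} r in c
cnext-irreflexive (suc r) () | zero
cnext-irreflexive {zero} (suc zero) eq | suc ()
cnext-irreflexive {suc m} (suc r) refl | suc r′ = cnext-irreflexive r c

module _ {n k : ℕ} where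

  proj₁-lookup∈elems : (M : Matching n k) (i : Fin (List.length M)) →
                       proj₁ (List.lookup M i) ∈ elems M
  proj₁-lookup∈elems (p ∷ M) zero    = here refl
  proj₁-lookup∈elems (p ∷ M) (suc i) = there (there (proj₁-lookup∈elems M i))

  lookup-proj₁-injective : (M : Matching n k) → Unique (elems M) →
    ∀ i j → proj₁ (List.lookup M i) ≡ proj₁ (List.lookup M j) → i ≡ j
  lookup-proj₁-injective (p ∷ M) (a∉ ∷ _ ∷ u) zero    zero    _  = refl
  lookup-proj₁-injective (p ∷ M) (a∉ ∷ _ ∷ u) zero    (suc j) eq =
    contradiction eq (All.lookup a∉ (there (proj₁-lookup∈elems M j)))
  lookup-proj₁-injective (p ∷ M) (a∉ ∷ _ ∷ u) (suc i) zero    eq =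
    contradiction (sym eq) (All.lookup a∉ (there (proj₁-lookup∈elems M i)))
  lookup-proj₁-injective (p ∷ M) (a∉ ∷ _ ∷ u) (suc i) (suc j) eq =
    cong suc (lookup-proj₁-injective M u i j eq)

  acyclic-by-potential : (M : Matching n k) → Unique (elems M) → (f : Pre n k → ℕ) →
    (∀ {p q} → p ∈ M → q ∈ M → proj₁ q ≢ proj₁ p → proj₁ q ≺ proj₂ p →
       f (proj₁ q) < f (proj₁ p)) →
    IsAcyclic M
  acyclic-by-potential M unique f decreasing (m , σ , σ-injective , cycle) =
    ℕ.<-irrefl refl (ℕ.<-≤-trans (descent r₀) (minimal (cnext r₀)))
    where
    g : Fin (suc (suc m)) → ℕ
    g r = f (proj₁ (List.lookup M (σ r)))
    r₀ : Fin (suc (suc m))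
    r₀ = argmin g zero (allFin _)
    minimal : ∀ r → g r₀ ≤ g r
    minimal r = All.lookup (f[argmin]≤f[xs] {f = g} zero (allFin _)) (∈-allFin r)
    descent : ∀ r → g (cnext r) < g r
    descent r = decreasing (∈-lookup (σ r)) (∈-lookup (σ (cnext r)))
      (λ eq → cnext-irreflexive r (σ-injective (lookup-proj₁-injective M unique _ _ eq)))
      (cycle r)

module _ {n k : ℕ} (f : Pre n k → Pre n k) where

  graph : List (Pre n k) → Matching n k
  graph = map (λ a → a , f a)

  ∈-elems-graph⁻ : ∀ xs {y} → y ∈ elems (graph xs) → ∃ λ a → a ∈ xs × (y ≡ a ⊎ y ≡ f a)
  ∈-elems-graph⁻ (a ∷ xs) (here y≡a)         = a , here refl , inj₁ y≡a
  ∈-elems-graph⁻ (a ∷ xs) (there (here y≡fa)) = a , here refl , inj₂ y≡fa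
  ∈-elems-graph⁻ (a ∷ xs) (there (there y∈)) with ∈-elems-graph⁻ xs y∈
  ... | b , b∈xs , y≡ = b , there b∈xs , y≡

  ∈-elems-graph⁺ : ∀ xs {a} → a ∈ xs → a ∈ elems (graph xs) × f a ∈ elems (graph xs)
  ∈-elems-graph⁺ (a ∷ xs) (here refl) = here refl , there (here refl)
  ∈-elems-graph⁺ (b ∷ xs) (there a∈xs) with ∈-elems-graph⁺ xs a∈xs
  ... | a∈ , fa∈ = there (there a∈) , there (there fa∈)

  unique-elems-graph : ∀ xs → Unique xs →
    (∀ {a b} → a ∈ xs → b ∈ xs → a ≢ f b) →
    (∀ {a b} → a ∈ xs → b ∈ xs → f a ≡ f b → a ≡ b) →
    Unique (elems (graph xs))
  unique-elems-graph []       _            _        _     = []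
  unique-elems-graph (a ∷ xs) (a∉xs ∷ uxs) disjoint inj =
    (disjoint (here refl) (here refl) ∷ All.tabulate a≢) ∷
    All.tabulate fa≢ ∷
    unique-elems-graph xs uxs (λ p q → disjoint (there p) (there q))
                              (λ p q → inj (there p) (there q))
    where
    a≢ : ∀ {y} → y ∈ elems (graph xs) → a ≢ y
    a≢ y∈ with ∈-elems-graph⁻ xs y∈
    ... | b , b∈xs , inj₁ refl = All.lookup a∉xs b∈xs
    ... | b , b∈xs , inj₂ refl = disjoint (here refl) (there b∈xs)
    fa≢ : ∀ {y} → y ∈ elems (graph xs) → f a ≢ y
    fa≢ y∈ with ∈-elems-graph⁻ xs y∈
    ... | b , b∈xs , inj₁ refl = disjoint (there b∈xs) (here refl) ∘ sym
    ... | b , b∈xs , inj₂ refl = All.lookup a∉xs b∈xs ∘ inj (here refl) (there b∈xs)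

allPre : ∀ m k → List (Pre m k)
allPre zero    k = Vec.[] ∷ []
allPre (suc m) k = cartesianProductWith Vec._∷_ (nothing ∷ map just (allFin k)) (allPre m k)

∈-allPre : ∀ {m k} (w : Pre m k) → w ∈ allPre m k
∈-allPre Vec.[]       = here refl
∈-allPre (x Vec.∷ w) = ∈-cartesianProductWith⁺ Vec._∷_ (entry x) (∈-allPre w)
  where
  entry : ∀ {k} (x : Maybe (Fin k)) → x ∈ nothing ∷ map just (allFin k)
  entry nothing  = here refl
  entry (just j) = there (∈-map⁺ just (∈-allFin j))

module _ {a} {A : Set a} where
  open import Data.Vec.Membership.Propositional {A = A} using () renaming (_∈_ to _∈ᵥ_)

  ∈-[]≔⁻ : ∀ {m} (xs : Vec A m) i {x y} → x ∈ᵥ xs [ i ]≔ y → x ≡ y ⊎ x ∈ᵥ xs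
  ∈-[]≔⁻ (_ ∷ xs) zero    (here eq) = inj₁ eq
  ∈-[]≔⁻ (_ ∷ xs) zero    (there p) = inj₂ (there p)
  ∈-[]≔⁻ (_ ∷ xs) (suc i) (here eq) = inj₂ (here eq)
  ∈-[]≔⁻ (_ ∷ xs) (suc i) (there p) = Sum.map₂ there (∈-[]≔⁻ xs i p)

  ∈-[]≔⁺ : ∀ {m} (xs : Vec A m) i {x y} → x ∈ᵥ xs → x ∈ᵥ xs [ i ]≔ y ⊎ lookup xs i ≡ x
  ∈-[]≔⁺ (_ ∷ xs) zero    (here eq) = inj₂ (sym eq)
  ∈-[]≔⁺ (_ ∷ xs) zero    (there p) = inj₁ (there p)
  ∈-[]≔⁺ (_ ∷ xs) (suc i) (here eq) = inj₁ (here eq)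
  ∈-[]≔⁺ (_ ∷ xs) (suc i) (there p) = Sum.map₁ there (∈-[]≔⁺ xs i p)

  []≔-revert : ∀ {m} (xs : Vec A m) i {y z} → lookup xs i ≡ y → (xs [ i ]≔ z) [ i ]≔ y ≡ xs
  []≔-revert xs i refl = trans ([]≔-idempotent xs i) ([]≔-lookup xs i)

leading-digit-< : ∀ {a a′ b b′ B : ℕ} → b < B → a < a′ → a * B + b < a′ * B + b′
leading-digit-< {a} {a′} {b} {b′} {B} b<B a<a′ = begin-strict
  a * B + b    <⟨ ℕ.+-monoʳ-< (a * B) b<B ⟩
  a * B + B    ≡⟨ ℕ.+-comm (a * B) B ⟩
  suc a * B    ≤⟨ ℕ.*-monoˡ-≤ B a<a′ ⟩
  a′ * B       ≤⟨ ℕ.m≤m+n (a′ * B) b′ ⟩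
  a′ * B + b′  ∎
  where open ℕ.≤-Reasoning

toFin? : (K r : ℕ) → Maybe (Fin K)
toFin? zero    r       = nothing
toFin? (suc K) zero    = just zero
toFin? (suc K) (suc r) = Maybe.map suc (toFin? K r)

toFin?-just : ∀ K r {x : Fin K} → toFin? K r ≡ just x → toℕ x ≡ r
toFin?-just (suc K) zero    refl = refl
toFin?-just (suc K) (suc r) eq with toFin? K r in e
toFin?-just (suc K) (suc r) refl | just y = cong suc (toFin?-just K r e)

toFin?-toℕ : ∀ K (x : Fin K) → toFin? K (toℕ x) ≡ just x
toFin?-toℕ (suc K) zero    = refl
toFin?-toℕ (suc K) (suc x) rewrite toFin?-toℕ K x = refl

toFin?-nothing : ∀ K r → toFin? K r ≡ nothing → K ≤ r
toFin?-nothing zero    r       _  = z≤n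
toFin?-nothing (suc K) (suc r) eq with toFin? K r in e
toFin?-nothing (suc K) (suc r) refl | nothing = s≤s (toFin?-nothing K r e)

toFin?-≥ : ∀ K r → K ≤ r → toFin? K r ≡ nothing
toFin?-≥ zero    r       _         = refl
toFin?-≥ (suc K) (suc r) (s≤s K≤r) rewrite toFin?-≥ K r K≤r = refl

module Toggle (k : ℕ) where
  open import Data.Vec.Membership.DecPropositional (≡-dec (_≟_ {k}))
    using (_∈?_) renaming (_∈_ to _∈ᵥ_)

  Entry : Set
  Entry = Maybe (Fin k)

  infix 4 _∈ᵢ_ _∈ᵢ?_ _⊑ₑ_ _⊑_

  _∈ᵢ_ : ∀ {m} → Fin k → Pre m k → Set
  j ∈ᵢ w = just j ∈ᵥ w

  _∈ᵢ?_ : ∀ {m} (j : Fin k) (w : Pre m k) → Dec (j ∈ᵢ w)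
  j ∈ᵢ? w = just j ∈? w

  Onto : ∀ {m} → Pre m k → Set
  Onto w = ∀ j → j ∈ᵢ w

  data _⊑ₑ_ : Entry → Entry → Set where
    nothing⊑ : ∀ {y} → nothing ⊑ₑ y
    just⊑    : ∀ {a} → just a ⊑ₑ just a

  _⊑_ : ∀ {m} → Pre m k → Pre m k → Set
  _⊑_ = Pointwise _⊑ₑ_

  ⊑ₑ-refl : ∀ {x} → x ⊑ₑ x
  ⊑ₑ-refl {nothing} = nothing⊑
  ⊑ₑ-refl {just _}  = just⊑

  size : ∀ {m} → Pre m k → ℕ
  size []            = 0
  size (nothing ∷ w) = size w
  size (just _ ∷ w)  = suc (size w)

  diagonalFrom : ℕ → (m : ℕ) → Pre m k
  diagonalFrom r zero    = []
  diagonalFrom r (suc m) = toFin? k r ∷ diagonalFrom (suc r) m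

  -- In phase diagonal r the entries scanned so far are 0, 1, …, r-1; in phase
  -- seeking c the value c has occurred off the diagonal.
  data Phase : Set where
    diagonal : ℕ → Phase
    seeking  : Fin k → Phase
    stuck    : Phase

  advance : Phase → Entry → Phase
  advance (diagonal r) nothing = stuck
  advance (diagonal r) (just x) with toℕ x ℕ.≟ r
  ... | yes _ = diagonal (suc r)
  ... | no  _ = seeking x
  advance (seeking c) _ = seeking c
  advance stuck       _ = stuck

  headToggle : ∀ {m} → Phase → Entry → Pre m k → Entry
  headToggle (diagonal r) nothing  w = toFin? k r
  headToggle (diagonal r) (just x) w with toℕ x ℕ.≟ r | x ∈ᵢ? w
  ... | yes _ | yes _ = just x
  ... | yes _ | no  _ = nothing
  ... | no  _ | _     = nothing
  headToggle (seeking c) nothing  w = just c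
  headToggle (seeking c) (just x) w with x ≟ c
  ... | yes _ = just c
  ... | no  _ = nothing
  headToggle stuck _ _ = nothing

  preferHead : ∀ {m} → Entry → Maybe (Fin m × Fin k) → Maybe (Fin (suc m) × Fin k)
  preferHead (just e) t = just (zero , e)
  preferHead nothing  t = Maybe.map (Product.map₁ suc) t

  toggle : ∀ {m} → Phase → Pre m k → Maybe (Fin m × Fin k)
  toggle s []      = nothing
  toggle s (x ∷ w) = preferHead (headToggle s x w) (toggle (advance s x) w)

  Covers : ∀ {m} → Phase → Pre m k → Set
  Covers (diagonal r) w = ∀ j → r ≤ toℕ j → j ∈ᵢ w
  Covers (seeking _)  w = ⊤
  Covers stuck        w = ⊤

  preferHead-zero⁻ : ∀ {m} a (t : Maybe (Fin m × Fin k)) {e} →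
                     preferHead a t ≡ just (zero , e) → a ≡ just e
  preferHead-zero⁻ (just e) t        refl = refl
  preferHead-zero⁻ nothing  (just _) ()

  preferHead-suc⁻ : ∀ {m} a (t : Maybe (Fin m × Fin k)) {i e} →
                    preferHead a t ≡ just (suc i , e) → a ≡ nothing × t ≡ just (i , e)
  preferHead-suc⁻ nothing (just _) refl = refl , refl

  preferHead-nothing⁻ : ∀ {m} a (t : Maybe (Fin m × Fin k)) →
                        preferHead a t ≡ nothing → a ≡ nothing × t ≡ nothing
  preferHead-nothing⁻ nothing nothing refl = refl , refl

  preferHead-suc⁺ : ∀ {m a} {t : Maybe (Fin m × Fin k)} {i e} →
                    a ≡ nothing → t ≡ just (i , e) → preferHead a t ≡ just (suc i , e)
  preferHead-suc⁺ refl refl = refl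

  toggle-zero⁻ : ∀ {m} s x (w : Pre m k) {e} → toggle s (x ∷ w) ≡ just (zero , e) →
                 headToggle s x w ≡ just e
  toggle-zero⁻ s x w = preferHead-zero⁻ (headToggle s x w) _

  toggle-suc⁻ : ∀ {m} s x (w : Pre m k) {i e} → toggle s (x ∷ w) ≡ just (suc i , e) →
                headToggle s x w ≡ nothing × toggle (advance s x) w ≡ just (i , e)
  toggle-suc⁻ s x w = preferHead-suc⁻ (headToggle s x w) _

  toggle-tail⁻ : ∀ {m} s x (w : Pre m k) {i e} → toggle s (x ∷ w) ≡ just (suc i , e) →
                 toggle (advance s x) w ≡ just (i , e)
  toggle-tail⁻ s x w = proj₂ ∘ toggle-suc⁻ s x w

  toggle-nothing⁻ : ∀ {m} s x (w : Pre m k) → toggle s (x ∷ w) ≡ nothing →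
                    headToggle s x w ≡ nothing × toggle (advance s x) w ≡ nothing
  toggle-nothing⁻ s x w = preferHead-nothing⁻ (headToggle s x w) _

  toggle-stuck : ∀ {m} (w : Pre m k) → toggle stuck w ≡ nothing
  toggle-stuck []      = refl
  toggle-stuck (x ∷ w) rewrite toggle-stuck w = refl

  toggle-seeking-value : ∀ {m} c (w : Pre m k) {i e} → toggle (seeking c) w ≡ just (i , e) → e ≡ c
  toggle-seeking-value c (nothing ∷ w) {zero} refl = refl
  toggle-seeking-value c (just y ∷ w)  {zero} eq
    with y ≟ c | toggle-zero⁻ (seeking c) (just y) w eq
  ... | yes _ | refl = refl
  toggle-seeking-value c (x ∷ w) {suc i} eq =
    toggle-seeking-value c w (toggle-tail⁻ (seeking c) x w eq)

  toggle-seeking-full : ∀ {m} c (w : Pre m k) → toggle (seeking c) w ≡ nothing → size w ≡ m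
  toggle-seeking-full c []           _  = refl
  toggle-seeking-full c (just x ∷ w) eq =
    cong suc (toggle-seeking-full c w (proj₂ (toggle-nothing⁻ (seeking c) (just x) w eq)))

  headToggle-just : ∀ {m} s y (w : Pre m k) {e} → headToggle s (just y) w ≡ just e → y ≡ e
  headToggle-just (diagonal r) y w h with toℕ y ℕ.≟ r | y ∈ᵢ? w | h
  ... | yes _ | yes _ | refl = refl
  headToggle-just (seeking c) y w h with y ≟ c | h
  ... | yes y≡c | refl = y≡c

  toggle-entry : ∀ {m} s (w : Pre m k) {i e} → toggle s w ≡ just (i , e) →
                 lookup w i ≡ nothing ⊎ lookup w i ≡ just e
  toggle-entry s (nothing ∷ w) {zero}  t = inj₁ refl
  toggle-entry s (just y ∷ w)  {zero}  t =
    inj₂ (cong just (headToggle-just s y w (toggle-zero⁻ s (just y) w t)))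
  toggle-entry s (x ∷ w)       {suc i} t =
    toggle-entry (advance s x) w (toggle-tail⁻ s x w t)

  toggle-diagonal-value : ∀ {m} r (w : Pre m k) {i e} → toggle (diagonal r) w ≡ just (i , e) →
                    e ∈ᵢ w ⊎ r ≤ toℕ e
  toggle-diagonal-value r (nothing ∷ w) {zero} t =
    inj₂ (ℕ.≤-reflexive (sym (toFin?-just k r (toggle-zero⁻ (diagonal r) nothing w t))))
  toggle-diagonal-value r (just y ∷ w)  {zero} t =
    inj₁ (here (cong just (sym (headToggle-just (diagonal r) y w
                                  (toggle-zero⁻ (diagonal r) (just y) w t)))))
  toggle-diagonal-value r (nothing ∷ w) {suc i} t =
    contradiction (trans (sym (toggle-stuck w)) (toggle-tail⁻ (diagonal r) nothing w t)) λ ()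
  toggle-diagonal-value r (just y ∷ w)  {suc i} t
    with toℕ y ℕ.≟ r | toggle-tail⁻ (diagonal r) (just y) w t
  ... | yes _ | t′ = Sum.map there (ℕ.≤-trans (ℕ.n≤1+n r)) (toggle-diagonal-value (suc r) w t′)
  ... | no  _ | t′ = inj₁ (here (cong just (toggle-seeking-value y w t′)))

  advance-seeking : ∀ s x {c} → advance s x ≡ seeking c → x ≡ just c ⊎ s ≡ seeking c
  advance-seeking (diagonal r) (just y) eq with toℕ y ℕ.≟ r | eq
  ... | no _ | refl = inj₁ refl
  advance-seeking (seeking c) x eq = inj₂ eq

  covers-tail : ∀ {m r x} {u : Pre m k} → (∀ {j} → x ≡ just j → toℕ j ≤ r) →
                Covers (diagonal r) (x ∷ u) → Covers (diagonal (suc r)) u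
  covers-tail x≤r cov j r<j with toSum (cov j (ℕ.<⇒≤ r<j))
  ... | inj₁ j≡x = contradiction (x≤r (sym j≡x)) (ℕ.<⇒≱ r<j)
  ... | inj₂ j∈u = j∈u

  covers-advance : ∀ {m} s x (w : Pre m k) → Covers s (x ∷ w) → Covers (advance s x) w
  covers-advance (diagonal r) nothing  w cov = tt
  covers-advance (diagonal r) (just y) w cov with toℕ y ℕ.≟ r
  ... | yes y≡r = covers-tail (λ { refl → ℕ.≤-reflexive y≡r }) cov
  ... | no  _   = tt
  covers-advance (seeking c) x w cov = tt
  covers-advance stuck       x w cov = tt

  ⊑-∈ᵢ : ∀ {m} {u w : Pre m k} {j} → u ⊑ w → j ∈ᵢ u → j ∈ᵢ w
  ⊑-∈ᵢ (just⊑ ∷ _)   (here refl) = here refl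
  ⊑-∈ᵢ (_     ∷ u⊑w) (there p)   = there (⊑-∈ᵢ u⊑w p)

  ∈ᵢ-delete⁻ : ∀ {m} (w : Pre m k) i {j} → j ∈ᵢ w [ i ]≔ nothing → j ∈ᵢ w
  ∈ᵢ-delete⁻ w i p = Sum.[ (λ ()) , (λ q → q) ]′ (∈-[]≔⁻ w i p)

  headToggle-tail-insert : ∀ {m} s x (w : Pre m k) i e → headToggle s x w ≡ nothing →
    toggle (advance s x) w ≡ just (i , e) → headToggle s x (w [ i ]≔ just e) ≡ nothing
  headToggle-tail-insert (diagonal r) nothing w i e h t = h
  headToggle-tail-insert (diagonal r) (just y) w i e h t
    with toℕ y ℕ.≟ r | y ∈ᵢ? w | y ∈ᵢ? (w [ i ]≔ just e) | h | t
  ... | no _  | _       | _        | _ | _ = refl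
  ... | yes _ | no _    | no _     | _ | _ = refl
  ... | yes y≡r | no y∉w | yes y∈w′ | _ | t′ with ∈-[]≔⁻ w i y∈w′
  ...   | inj₂ y∈w  = contradiction y∈w y∉w
  ...   | inj₁ refl with toggle-diagonal-value (suc r) w t′
  ...     | inj₁ y∈w = contradiction y∈w y∉w
  ...     | inj₂ r<y = contradiction r<y (ℕ.<-irrefl (sym y≡r))
  headToggle-tail-insert (seeking c) nothing  w i e h t = h
  headToggle-tail-insert (seeking c) (just y) w i e h t = h
  headToggle-tail-insert stuck       x        w i e h t = refl

  headToggle-tail-delete : ∀ {m} s x (w : Pre m k) i → headToggle s x w ≡ nothing →
                      headToggle s x (w [ i ]≔ nothing) ≡ nothing
  headToggle-tail-delete (diagonal r) nothing w i h = h
  headToggle-tail-delete (diagonal r) (just y) w i h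
    with toℕ y ℕ.≟ r | y ∈ᵢ? w | y ∈ᵢ? (w [ i ]≔ nothing) | h
  ... | no _  | _      | _        | _ = refl
  ... | yes _ | no _   | no _     | _ = refl
  ... | yes _ | no y∉w | yes y∈w′ | _ = contradiction (∈ᵢ-delete⁻ w i y∈w′) y∉w
  headToggle-tail-delete (seeking c) nothing  w i h = h
  headToggle-tail-delete (seeking c) (just y) w i h = h
  headToggle-tail-delete stuck       x        w i h = refl

  headToggle-filled : ∀ {m} s (w : Pre m k) e → headToggle s nothing w ≡ just e →
                    Covers s (nothing ∷ w) → headToggle s (just e) w ≡ just e
  headToggle-filled (diagonal r) w e h cov with toFin?-just k r h
  ... | refl with toℕ e ℕ.≟ toℕ e | e ∈ᵢ? w
  ...   | no e≢e | _     = contradiction refl e≢e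
  ...   | yes _  | yes _ = refl
  ...   | yes _  | no e∉w with cov e ℕ.≤-refl
  ...     | there e∈w = contradiction e∈w e∉w
  headToggle-filled (seeking c) w e refl cov with c ≟ c
  ... | yes _  = refl
  ... | no c≢c = contradiction refl c≢c

  headToggle-emptied : ∀ {m} s (w : Pre m k) e → headToggle s (just e) w ≡ just e →
                     headToggle s nothing w ≡ just e
  headToggle-emptied (diagonal r) w e h with toℕ e ℕ.≟ r | e ∈ᵢ? w | h
  ... | yes refl | yes _ | _ = toFin?-toℕ k e
  headToggle-emptied (seeking c) w e h with e ≟ c | h
  ... | yes refl | _ = refl

  toggle-insert : ∀ {m} s (w : Pre m k) i e → toggle s w ≡ just (i , e) →
                  lookup w i ≡ nothing → Covers s w → toggle s (w [ i ]≔ just e) ≡ just (i , e)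
  toggle-insert s (x ∷ w) zero e t refl cov
    rewrite headToggle-filled s w e (toggle-zero⁻ s nothing w t) cov = refl
  toggle-insert s (x ∷ w) (suc i) e t l cov with toggle-suc⁻ s x w t
  ... | h , t′ = preferHead-suc⁺ (headToggle-tail-insert s x w i e h t′)
                   (toggle-insert (advance s x) w i e t′ l (covers-advance s x w cov))

  toggle-delete : ∀ {m} s (w : Pre m k) i e → toggle s w ≡ just (i , e) →
                  lookup w i ≡ just e → toggle s (w [ i ]≔ nothing) ≡ just (i , e)
  toggle-delete s (x ∷ w) zero e t refl
    rewrite headToggle-emptied s w e (toggle-zero⁻ s (just e) w t) = refl
  toggle-delete s (x ∷ w) (suc i) e t l with toggle-suc⁻ s x w t
  ... | h , t′ = preferHead-suc⁺ (headToggle-tail-delete s x w i h)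
                   (toggle-delete (advance s x) w i e t′ l)

  toggle-delete-keeps : ∀ {m} s (w : Pre m k) i e → toggle s w ≡ just (i , e) →
                        lookup w i ≡ just e → e ∈ᵢ w [ i ]≔ nothing ⊎ s ≡ seeking e
  toggle-delete-keeps (diagonal r) (x ∷ w) zero e t refl
    with toℕ e ℕ.≟ r | e ∈ᵢ? w | toggle-zero⁻ (diagonal r) (just e) w t
  ... | yes _ | yes e∈w | _ = inj₁ (there e∈w)
  toggle-delete-keeps (seeking c) (x ∷ w) zero e t refl
    with e ≟ c | toggle-zero⁻ (seeking c) (just e) w t
  ... | yes refl | _ = inj₂ refl
  toggle-delete-keeps stuck (x ∷ w) zero e t refl =
    contradiction (toggle-zero⁻ stuck (just e) w t) λ ()
  toggle-delete-keeps s (x ∷ w) (suc i) e t l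
    with toggle-delete-keeps (advance s x) w i e (toggle-tail⁻ s x w t) l
  ... | inj₁ e∈w′ = inj₁ (there e∈w′)
  ... | inj₂ eq   = Sum.map₁ (λ x≡e → here (sym x≡e)) (advance-seeking s x eq)

  diagonalFrom-∈ᵢ : ∀ r m {j} → j ∈ᵢ diagonalFrom r m → r ≤ toℕ j
  diagonalFrom-∈ᵢ r (suc m) (here eq) = ℕ.≤-reflexive (sym (toFin?-just k r (sym eq)))
  diagonalFrom-∈ᵢ r (suc m) (there p) = ℕ.≤-trans (ℕ.n≤1+n r) (diagonalFrom-∈ᵢ (suc r) m p)

  diagonalFrom-onto : ∀ r m j → r ≤ toℕ j → toℕ j < r + m → j ∈ᵢ diagonalFrom r m
  diagonalFrom-onto r zero j r≤j j<r+0 =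
    contradiction r≤j (ℕ.<⇒≱ (subst (toℕ j <_) (ℕ.+-identityʳ r) j<r+0))
  diagonalFrom-onto r (suc m) j r≤j j<r+1+m with toℕ j ℕ.≟ r
  ... | yes refl = here (sym (toFin?-toℕ k j))
  ... | no j≢r   = there (diagonalFrom-onto (suc r) m j (ℕ.≤∧≢⇒< r≤j (j≢r ∘ sym))
                                           (subst (toℕ j <_) (ℕ.+-suc r m) j<r+1+m))

  toggle-diagonalFrom : ∀ r m → toggle (diagonal r) (diagonalFrom r m) ≡ nothing
  toggle-diagonalFrom r zero = refl
  toggle-diagonalFrom r (suc m) with toFin? k r in eq
  ... | nothing rewrite eq | toggle-stuck (diagonalFrom (suc r) m) = refl
  ... | just x with toℕ x ℕ.≟ r | x ∈ᵢ? diagonalFrom (suc r) m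
  ...   | no x≢r | _     = contradiction (toFin?-just k r eq) x≢r
  ...   | yes x≡r | yes x∈ =
    contradiction (diagonalFrom-∈ᵢ (suc r) m x∈) (ℕ.<-irrefl (sym x≡r))
  ...   | yes _ | no _ rewrite toggle-diagonalFrom (suc r) m = refl

  valueless⇒diagonalFrom : ∀ r m (w : Pre m k) → k ≤ r → (∀ j → ¬ j ∈ᵢ w) → w ≡ diagonalFrom r m
  valueless⇒diagonalFrom r zero    []            k≤r none = refl
  valueless⇒diagonalFrom r (suc m) (nothing ∷ w) k≤r none =
    cong₂ _∷_ (sym (toFin?-≥ k r k≤r))
      (valueless⇒diagonalFrom (suc r) m w (ℕ.m≤n⇒m≤1+n k≤r) (λ j j∈w → none j (there j∈w)))
  valueless⇒diagonalFrom r (suc m) (just y ∷ w)  k≤r none = contradiction (here refl) (none y)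

  ⊑-diagonalFrom⇒≡ : ∀ r m (u : Pre m k) → u ⊑ diagonalFrom r m → Covers (diagonal r) u →
                        u ≡ diagonalFrom r m
  ⊑-diagonalFrom⇒≡ r zero    []      []          cov = refl
  ⊑-diagonalFrom⇒≡ r (suc m) (x ∷ u) (x⊑ ∷ u⊑) cov with toFin? k r in eq
  ... | nothing with x⊑
  ...   | nothing⊑ =
    cong (nothing ∷_) (⊑-diagonalFrom⇒≡ (suc r) m u u⊑ (covers-tail (λ ()) cov))
  ⊑-diagonalFrom⇒≡ r (suc m) (x ∷ u) (x⊑ ∷ u⊑) cov | just d
    with toSum (cov d (ℕ.≤-reflexive (sym (toFin?-just k r eq))))
  ... | inj₂ d∈u = contradiction (diagonalFrom-∈ᵢ (suc r) m (⊑-∈ᵢ u⊑ d∈u))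
                                 (ℕ.<-irrefl (sym (toFin?-just k r eq)))
  ... | inj₁ refl = cong (just d ∷_) (⊑-diagonalFrom⇒≡ (suc r) m u u⊑
                      (covers-tail (λ { refl → ℕ.≤-reflexive (toFin?-just k r eq) }) cov))

  untoggled-diagonal : ∀ r m (w : Pre m k) → toggle (diagonal r) w ≡ nothing →
              (∀ j → toℕ j < r → ¬ j ∈ᵢ w) → size w ≡ m ⊎ w ≡ diagonalFrom r m
  untoggled-diagonal r zero [] _ _ = inj₁ refl
  untoggled-diagonal r (suc m) (nothing ∷ w) t below
    with toggle-nothing⁻ (diagonal r) nothing w t
  ... | none , _ = inj₂ (valueless⇒diagonalFrom r (suc m) (nothing ∷ w) k≤r
                           (λ j → below j (ℕ.<-≤-trans (Fin.toℕ<n j) k≤r)))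
    where
    k≤r : k ≤ r
    k≤r = toFin?-nothing k r none
  untoggled-diagonal r (suc m) (just y ∷ w) t below with toℕ y ℕ.≟ r | y ∈ᵢ? w | t
  ... | no _ | _ | t′ =
    inj₁ (cong suc (toggle-seeking-full y w (proj₂ (preferHead-nothing⁻ nothing _ t′))))
  ... | yes refl | no y∉w | t′ =
    Sum.map (cong suc) (cong₂ _∷_ (sym (toFin?-toℕ k y)))
      (untoggled-diagonal (suc (toℕ y)) m w (proj₂ (preferHead-nothing⁻ nothing _ t′)) below′)
    where
    below′ : ∀ j → toℕ j < suc (toℕ y) → ¬ j ∈ᵢ w
    below′ j j≤y j∈w with toℕ j ℕ.≟ toℕ y
    ... | yes j≡y = y∉w (subst (_∈ᵢ w) (Fin.toℕ-injective j≡y) j∈w)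
    ... | no  j≢y = below j (ℕ.≤∧≢⇒< (ℕ.≤-pred j≤y) j≢y) (there j∈w)

  size-⊑ : ∀ {m} {u w : Pre m k} → u ⊑ w → size u ≤ size w
  size-⊑ [] = z≤n
  size-⊑ {u = nothing ∷ _} {nothing ∷ _} (nothing⊑ ∷ u⊑w) = size-⊑ u⊑w
  size-⊑ {u = nothing ∷ _} {just _ ∷ _}  (nothing⊑ ∷ u⊑w) = ℕ.m≤n⇒m≤1+n (size-⊑ u⊑w)
  size-⊑ (just⊑ ∷ u⊑w) = s≤s (size-⊑ u⊑w)

  ⊑-size-≡ : ∀ {m} {u w : Pre m k} → u ⊑ w → size w ≤ size u → u ≡ w
  ⊑-size-≡ [] _ = refl
  ⊑-size-≡ {u = nothing ∷ _} {nothing ∷ _} (nothing⊑ ∷ u⊑w) le = cong (nothing ∷_) (⊑-size-≡ u⊑w le)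
  ⊑-size-≡ {u = nothing ∷ _} {just _ ∷ _}  (nothing⊑ ∷ u⊑w) le =
    contradiction (ℕ.≤-trans le (size-⊑ u⊑w)) (ℕ.<-irrefl refl)
  ⊑-size-≡ (just⊑ ∷ u⊑w) (s≤s le) = cong (just _ ∷_) (⊑-size-≡ u⊑w le)

  size-insert : ∀ {m} (w : Pre m k) i e → lookup w i ≡ nothing →
                size (w [ i ]≔ just e) ≡ suc (size w)
  size-insert (x ∷ w)       zero    e refl = refl
  size-insert (nothing ∷ w) (suc i) e l    = size-insert w i e l
  size-insert (just _ ∷ w)  (suc i) e l    = cong suc (size-insert w i e l)

  ∈ᵢ⇒size>0 : ∀ {m} {w : Pre m k} {j} → j ∈ᵢ w → 0 < size w
  ∈ᵢ⇒size>0 {w = just _ ∷ w}  (here _)  = s≤s z≤n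
  ∈ᵢ⇒size>0 {w = just _ ∷ w}  (there p) = s≤s z≤n
  ∈ᵢ⇒size>0 {w = nothing ∷ w} (there p) = ∈ᵢ⇒size>0 p

  ⊑-insert : ∀ {m} (w : Pre m k) i e → lookup w i ≡ nothing → w ⊑ w [ i ]≔ just e
  ⊑-insert (x ∷ w) zero    e refl = nothing⊑ ∷ Pointwise.refl ⊑ₑ-refl
  ⊑-insert (x ∷ w) (suc i) e l    = ⊑ₑ-refl ∷ ⊑-insert w i e l

  ⊑ₑ-antisym : ∀ {x y} → x ⊑ₑ y → y ⊑ₑ x → x ≡ y
  ⊑ₑ-antisym nothing⊑ nothing⊑ = refl
  ⊑ₑ-antisym just⊑    just⊑    = refl

  ⊑-antisym : ∀ {m} {u w : Pre m k} → u ⊑ w → w ⊑ u → u ≡ w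
  ⊑-antisym []          []          = refl
  ⊑-antisym (p ∷ u⊑w) (q ∷ w⊑u) = cong₂ _∷_ (⊑ₑ-antisym p q) (⊑-antisym u⊑w w⊑u)

  ⊑-insert-interval : ∀ {m} (a c : Pre m k) i e → lookup a i ≡ nothing →
                      a ⊑ c → c ⊑ a [ i ]≔ just e → c ≡ a ⊎ c ≡ a [ i ]≔ just e
  ⊑-insert-interval (x ∷ a) (y ∷ c) zero e refl (nothing⊑ ∷ a⊑c) (nothing⊑ ∷ c⊑a) =
    inj₁ (cong (nothing ∷_) (⊑-antisym c⊑a a⊑c))
  ⊑-insert-interval (x ∷ a) (y ∷ c) zero e refl (nothing⊑ ∷ a⊑c) (just⊑ ∷ c⊑a) =
    inj₂ (cong (just e ∷_) (⊑-antisym c⊑a a⊑c))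
  ⊑-insert-interval (x ∷ a) (y ∷ c) (suc i) e l (p ∷ a⊑c) (q ∷ c⊑a) =
    Sum.map (cong₂ _∷_ (⊑ₑ-antisym q p)) (cong₂ _∷_ (⊑ₑ-antisym q p))
      (⊑-insert-interval a c i e l a⊑c c⊑a)

  entryRank : Phase → Entry → ℕ
  entryRank s nothing = 1
  entryRank (diagonal r) (just x) with toℕ x ℕ.≟ r
  ... | yes _ = 0
  ... | no  _ = 2
  entryRank (seeking c) (just x) with x ≟ c
  ... | yes _ = 0
  ... | no  _ = 2
  entryRank stuck (just x) = 2

  lexRank : ∀ {m} → Phase → Pre m k → ℕ
  lexRank s [] = 0
  lexRank {suc m} s (x ∷ w) = entryRank s x * 3 ^ m + lexRank (advance s x) w

  entryRank≤2 : ∀ s x → entryRank s x ≤ 2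
  entryRank≤2 s nothing = s≤s z≤n
  entryRank≤2 (diagonal r) (just x) with toℕ x ℕ.≟ r
  ... | yes _ = z≤n
  ... | no  _ = ℕ.≤-refl
  entryRank≤2 (seeking c) (just x) with x ≟ c
  ... | yes _ = z≤n
  ... | no  _ = ℕ.≤-refl
  entryRank≤2 stuck (just x) = ℕ.≤-refl

  lexRank<3^ : ∀ {m} s (w : Pre m k) → lexRank s w < 3 ^ m
  lexRank<3^ s [] = s≤s z≤n
  lexRank<3^ {suc m} s (x ∷ w) = begin-strict
    entryRank s x * 3 ^ m + lexRank (advance s x) w
      <⟨ ℕ.+-monoʳ-< _ (lexRank<3^ (advance s x) w) ⟩
    entryRank s x * 3 ^ m + 3 ^ m
      ≤⟨ ℕ.+-monoˡ-≤ (3 ^ m) (ℕ.*-monoˡ-≤ (3 ^ m) (entryRank≤2 s x)) ⟩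
    2 * 3 ^ m + 3 ^ m
      ≡⟨ ℕ.+-comm (2 * 3 ^ m) (3 ^ m) ⟩
    3 ^ suc m ∎
    where open ℕ.≤-Reasoning

  lexRank-head< : ∀ {m} s x y (u w : Pre m k) → entryRank s x < entryRank s y →
                  lexRank s (x ∷ u) < lexRank s (y ∷ w)
  lexRank-head< s x y u w = leading-digit-< (lexRank<3^ (advance s x) u)

  entryRank-toggled : ∀ {m} s (w : Pre m k) e → headToggle s nothing w ≡ just e →
                      entryRank s (just e) ≡ 0
  entryRank-toggled (diagonal r) w e h with toFin?-just k r h
  ... | refl with toℕ e ℕ.≟ toℕ e
  ...   | yes _  = refl
  ...   | no e≢e = contradiction refl e≢e
  entryRank-toggled (seeking c) w e refl with c ≟ c
  ... | yes _  = refl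
  ... | no c≢c = contradiction refl c≢c

  entryRank-untoggled : ∀ {m} s y (w u : Pre m k) → headToggle s (just y) w ≡ nothing →
                        Covers s (nothing ∷ u) → u ⊑ w → entryRank s (just y) ≡ 2
  entryRank-untoggled (diagonal r) y w u h cov u⊑w with toℕ y ℕ.≟ r | y ∈ᵢ? w | h
  ... | no _    | _      | _ = refl
  ... | yes y≡r | no y∉w | _ with cov y (ℕ.≤-reflexive (sym y≡r))
  ...   | there y∈u = contradiction (⊑-∈ᵢ u⊑w y∈u) y∉w
  entryRank-untoggled (seeking c) y w u h cov u⊑w with y ≟ c | h
  ... | no _ | _ = refl
  entryRank-untoggled stuck y w u h cov u⊑w = refl

  -- u is a [ i ]≔ just e with some entry j ≠ i deleted.  If j < i the words first
  -- differ at j, where u is empty (rank 1) and a is not toggled (rank 2); if j > i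
  -- they first differ at i, where u holds e (rank 0) and a is empty (rank 1).
  lexRank-facet< : ∀ {m} s (u a : Pre m k) i e →
                   toggle s a ≡ just (i , e) → lookup a i ≡ nothing → Covers s u →
                   u ⊑ a [ i ]≔ just e → size u ≡ size a → u ≢ a → lexRank s u < lexRank s a
  lexRank-facet< s (y ∷ u) (x ∷ w) zero e t refl cov (nothing⊑ ∷ u⊑w) sz u≢a =
    contradiction (cong (nothing ∷_) (⊑-size-≡ u⊑w (ℕ.≤-reflexive (sym sz)))) u≢a
  lexRank-facet< s (y ∷ u) (x ∷ w) zero e t refl cov (just⊑ ∷ u⊑w) sz u≢a =
    lexRank-head< s (just e) nothing u w
      (ℕ.≤-reflexive (cong suc (entryRank-toggled s w e (toggle-zero⁻ s nothing w t))))
  lexRank-facet< s (y ∷ u) (nothing ∷ w) (suc i) e t l cov (nothing⊑ ∷ u⊑w) sz u≢a =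
    ℕ.+-monoʳ-< _ (lexRank-facet< (advance s nothing) u w i e (toggle-tail⁻ s nothing w t) l
                     (covers-advance s nothing u cov) u⊑w sz (u≢a ∘ cong (nothing ∷_)))
  lexRank-facet< s (y ∷ u) (just z ∷ w) (suc i) e t l cov (nothing⊑ ∷ u⊑w) sz u≢a
    with toggle-suc⁻ s (just z) w t
  ... | h , t′ = lexRank-head< s nothing (just z) u w
                   (ℕ.≤-reflexive (sym (entryRank-untoggled s z (w [ i ]≔ just e) u
                     (headToggle-tail-insert s (just z) w i e h t′) cov u⊑w)))
  lexRank-facet< s (y ∷ u) (just z ∷ w) (suc i) e t l cov (just⊑ ∷ u⊑w) sz u≢a =
    ℕ.+-monoʳ-< _ (lexRank-facet< (advance s (just z)) u w i e (toggle-tail⁻ s (just z) w t) l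
                     (covers-advance s (just z) u cov) u⊑w (ℕ.suc-injective sz)
                     (u≢a ∘ cong (just z ∷_)))

  lookup⇒∈ᵢ : ∀ {m} (w : Pre m k) i {j} → lookup w i ≡ just j → j ∈ᵢ w
  lookup⇒∈ᵢ w i eq = subst (_∈ᵥ w) eq (∈ᵥ-lookup i w)

  ∈ᵢ⇒lookup : ∀ {m} {w : Pre m k} {j} → j ∈ᵢ w → ∃ λ i → lookup w i ≡ just j
  ∈ᵢ⇒lookup j∈w = Any.index j∈w , sym (lookup-index j∈w)

  ⪯⇒⊑ : ∀ {m} {u w : Pre m k} → u ⪯ w → u ⊑ w
  ⪯⇒⊑ {u = []}          {[]}    _   = []
  ⪯⇒⊑ {u = nothing ∷ u} {y ∷ w} u⪯w = nothing⊑ ∷ ⪯⇒⊑ (u⪯w ∘ suc)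
  ⪯⇒⊑ {u = just x ∷ u}  {y ∷ w} u⪯w with u⪯w zero x refl
  ... | refl = just⊑ ∷ ⪯⇒⊑ (u⪯w ∘ suc)

  ⊑⇒⪯ : ∀ {m} {u w : Pre m k} → u ⊑ w → u ⪯ w
  ⊑⇒⪯ (just⊑ ∷ _)   zero    j eq = eq
  ⊑⇒⪯ (_     ∷ u⊑w) (suc i) j eq = ⊑⇒⪯ u⊑w i j eq

  empty : ∀ m → Pre m k
  empty m = replicate m nothing

  ∉ᵢ-empty : ∀ {m j} → ¬ j ∈ᵢ empty m
  ∉ᵢ-empty {suc m} (there p) = ∉ᵢ-empty p

  size-empty : ∀ m → size (empty m) ≡ 0
  size-empty zero    = refl
  size-empty (suc m) = size-empty m

  lookup-nothing⇒empty : ∀ {m} (w : Pre m k) → (∀ i → lookup w i ≡ nothing) → w ≡ empty m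
  lookup-nothing⇒empty []      _     = refl
  lookup-nothing⇒empty (x ∷ w) none with none zero
  ... | refl = cong (nothing ∷_) (lookup-nothing⇒empty w (none ∘ suc))

indicator : ∀ {K} → Maybe (Fin K) → Fin K → ℕ
indicator x j = if does (≡-dec _≟_ x (just j)) then 1 else 0

sum-indicator : ∀ {K} (a : Fin K) → sum (indicator (just a)) ≡ 1
sum-indicator {suc K} zero    = cong suc (sum-replicate-zero K)
sum-indicator {suc K} (suc a) = sum-indicator a

blockSize-∷ : ∀ {m K} x (w : Pre m K) j → blockSize (x ∷ w) j ≡ indicator x j + blockSize w j
blockSize-∷ x w j with ≡-dec _≟_ x (just j)
... | yes _ = refl
... | no  _ = refl

sumℤ-tabulate-pred : ∀ K (f : Fin K → ℕ) →
  sumℤ (List.tabulate (λ j → + f j ℤ.- + 1)) ≡ + sum f ℤ.- + K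
sumℤ-tabulate-pred zero    f = refl
sumℤ-tabulate-pred (suc K) f = begin
  (+ f zero ℤ.- + 1) ℤ.+ sumℤ (List.tabulate (λ j → + f (suc j) ℤ.- + 1))
    ≡⟨ cong (λ s → (+ f zero ℤ.- + 1) ℤ.+ s) (sumℤ-tabulate-pred K (f ∘ suc)) ⟩
  (+ f zero ℤ.- + 1) ℤ.+ (+ sum (f ∘ suc) ℤ.- + K)
    ≡⟨ regroup (+ f zero) (+ sum (f ∘ suc)) (+ K) ⟩
  (+ f zero ℤ.+ + sum (f ∘ suc)) ℤ.- (+ 1 ℤ.+ + K)
    ≡⟨ sym (cong₂ ℤ._-_ (ℤ.pos-+ (f zero) (sum (f ∘ suc))) (ℤ.pos-+ 1 K)) ⟩
  + sum f ℤ.- + suc K ∎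
  where
  open ≡-Reasoning
  regroup : ∀ a b c → (a ℤ.- + 1) ℤ.+ (b ℤ.- c) ≡ (a ℤ.+ b) ℤ.- (+ 1 ℤ.+ c)
  regroup = solve-∀

module Dimension (k : ℕ) where
  open Toggle k

  sum-blockSize : ∀ {m} (w : Pre m k) → sum (blockSize w) ≡ size w
  sum-blockSize []      = sum-replicate-zero k
  sum-blockSize (x ∷ w) =
    trans (sum-cong-≗ (blockSize-∷ x w)) (trans (∑-distrib-+ (indicator x) (blockSize w)) (split x))
    where
    split : ∀ x → sum (indicator x) + sum (blockSize w) ≡ size (x ∷ w)
    split nothing  = trans (cong (_+ sum (blockSize w)) (sum-replicate-zero k)) (sum-blockSize w)
    split (just a) = cong₂ _+_ (sum-indicator a) (sum-blockSize w)

  isEmptyFace⇒size≡0 : ∀ {m} (w : Pre m k) → isEmptyFace w ≡ true → size w ≡ 0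
  isEmptyFace⇒size≡0 []            _  = refl
  isEmptyFace⇒size≡0 (nothing ∷ w) eq = isEmptyFace⇒size≡0 w eq

  dim-full : ∀ {m} (w : Pre m k) → size w ≡ m → 0 < m → k ≤ m → dim w ≡ + (m ∸ k)
  dim-full {m} w full 0<m k≤m with isEmptyFace w in empty?
  ... | true  = contradiction (trans (sym full) (isEmptyFace⇒size≡0 w empty?)) (ℕ.>⇒≢ 0<m)
  ... | false = begin
    sumℤ (List.map (λ j → + blockSize w j ℤ.- + 1) (List.allFin k))
      ≡⟨ cong sumℤ (List.map-tabulate (λ j → j) (λ j → + blockSize w j ℤ.- + 1)) ⟩
    sumℤ (List.tabulate (λ j → + blockSize w j ℤ.- + 1))
      ≡⟨ sumℤ-tabulate-pred k (blockSize w) ⟩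
    + sum (blockSize w) ℤ.- + k
      ≡⟨ cong (λ s → + s ℤ.- + k) (trans (sum-blockSize w) full) ⟩
    + m ℤ.- + k
      ≡⟨ ℤ.m-n≡m⊖n m k ⟩
    m ℤ.⊖ k
      ≡⟨ ℤ.⊖-≥ k≤m ⟩
    + (m ∸ k) ∎
    where open ≡-Reasoning

module Construction (n k : ℕ) (1≤k : 1 ≤ k) (k<n : k < n) where
  open Toggle k
  open Dimension k

  toggle₀ : Pre n k → Maybe (Fin n × Fin k)
  toggle₀ = toggle (diagonal 0)

  j₀ : Fin k
  j₀ = Fin.fromℕ< 1≤k

  vertex : Pre n k
  vertex = diagonalFrom 0 n

  covers₀ : ∀ {a : Pre n k} → Onto a → Covers (diagonal 0) a
  covers₀ onto j _ = onto j

  vertex-onto : Onto vertex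
  vertex-onto j = diagonalFrom-onto 0 n j z≤n (ℕ.<-trans (Fin.toℕ<n j) k<n)

  empty-not-onto : ¬ Onto (empty n)
  empty-not-onto onto = ∉ᵢ-empty (onto j₀)

  record Lower (a : Pre n k) : Set where
    constructor lower
    field
      onto     : Onto a
      position : Fin n
      value    : Fin k
      toggled  : toggle₀ a ≡ just (position , value)
      hole     : lookup a position ≡ nothing

  lower? : Decidable Lower
  lower? a with Fin.all? (_∈ᵢ? a) | toggle₀ a in t
  ... | no ¬onto | _      = no (¬onto ∘ Lower.onto)
  ... | yes onto | nothing = no λ la → contradiction (trans (sym t) (Lower.toggled la)) λ ()
  ... | yes onto | just (i , e) with lookup a i in l
  ...   | nothing = yes (lower onto i e t l)
  ...   | just _  = no λ { (lower _ _ _ t′ l′) → filled (trans (sym t) t′) l′ }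
    where
    filled : ∀ {i′ e′} → just (i , e) ≡ just (i′ , e′) → lookup a i′ ≡ nothing → ⊥
    filled refl l′ = contradiction (trans (sym l) l′) λ ()

  raise : Pre n k → Pre n k
  raise a = Maybe.maybe (λ p → a [ proj₁ p ]≔ just (proj₂ p)) a (toggle₀ a)

  raise-≡ : ∀ a {i e} → toggle₀ a ≡ just (i , e) → raise a ≡ a [ i ]≔ just e
  raise-≡ a t rewrite t = refl

  toggle₀-raise : ∀ {a} → Lower a → toggle₀ (raise a) ≡ toggle₀ a
  toggle₀-raise {a} (lower onto i e t l) =
    trans (cong toggle₀ (raise-≡ a t))
          (trans (toggle-insert (diagonal 0) a i e t l (covers₀ onto)) (sym t))

  ⊑-raise : ∀ {a} → Lower a → a ⊑ raise a
  ⊑-raise {a} (lower _ i e t l) = subst (a ⊑_) (sym (raise-≡ a t)) (⊑-insert a i e l)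

  raise-onto : ∀ {a} → Lower a → Onto (raise a)
  raise-onto la@(lower onto _ _ _ _) j = ⊑-∈ᵢ (⊑-raise la) (onto j)

  lower≢raise : ∀ {a b} → Lower a → Lower b → a ≢ raise b
  lower≢raise {a} {b} (lower _ i e t l) lb@(lower _ _ _ t′ _) a≡rb
    with trans (sym t) (trans (cong toggle₀ a≡rb) (trans (toggle₀-raise lb) t′))
  ... | refl = contradiction (trans (sym l) a[i]≡e) λ ()
    where
    a[i]≡e : lookup a i ≡ just e
    a[i]≡e = trans (cong (λ w → lookup w i) (trans a≡rb (raise-≡ b t′)))
                   (lookup∘update i b (just e))

  raise-≡⇒toggle₀-≡ : ∀ {a b} → Lower a → Lower b → raise a ≡ raise b → toggle₀ a ≡ toggle₀ b
  raise-≡⇒toggle₀-≡ la lb ra≡rb =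
    trans (sym (toggle₀-raise la)) (trans (cong toggle₀ ra≡rb) (toggle₀-raise lb))

  raise-injective : ∀ {a b} → Lower a → Lower b → raise a ≡ raise b → a ≡ b
  raise-injective {a} {b} la@(lower _ i e t l) lb@(lower _ _ _ t′ l′) ra≡rb
    with trans (sym t) (trans (raise-≡⇒toggle₀-≡ la lb ra≡rb) t′)
  ... | refl = begin
    a                                 ≡⟨ sym ([]≔-revert a i l) ⟩
    (a [ i ]≔ just e) [ i ]≔ nothing  ≡⟨ cong (_[ i ]≔ nothing) a⁺≡b⁺ ⟩
    (b [ i ]≔ just e) [ i ]≔ nothing  ≡⟨ []≔-revert b i l′ ⟩
    b                                 ∎
    where
    open ≡-Reasoning
    a⁺≡b⁺ : a [ i ]≔ just e ≡ b [ i ]≔ just e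
    a⁺≡b⁺ = trans (sym (raise-≡ a t)) (trans ra≡rb (raise-≡ b t′))

  _≟ₚ_ : (u v : Pre n k) → Dec (u ≡ v)
  _≟ₚ_ = Vec.≡-dec (≡-dec Fin._≟_)

  lowers : List (Pre n k)
  lowers = filter lower? (deduplicate _≟ₚ_ (allPre n k))

  ∈-lowers⁺ : ∀ {a} → Lower a → a ∈ lowers
  ∈-lowers⁺ la = ∈-filter⁺ lower? (∈-deduplicate⁺ _≟ₚ_ (∈-allPre _)) la

  ∈-lowers⁻ : ∀ {a} → a ∈ lowers → Lower a
  ∈-lowers⁻ a∈ = proj₂ (∈-filter⁻ lower? {xs = deduplicate _≟ₚ_ (allPre n k)} a∈)

  M : Matching n k
  M = (empty n , vertex) ∷ graph raise lowers

  data Matched : Pre n k → Pre n k → Set where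
    empty-vertex : Matched (empty n) vertex
    lower-raise  : ∀ {a} → Lower a → Matched a (raise a)

  ∈-M⁻ : ∀ {p} → p ∈ M → Matched (proj₁ p) (proj₂ p)
  ∈-M⁻ (here refl) = empty-vertex
  ∈-M⁻ (there p∈)  with ∈-map⁻ (λ a → a , raise a) p∈
  ... | a , a∈ , refl = lower-raise (∈-lowers⁻ a∈)

  ∈-elems-M : ∀ {v : Pre n k} → Lower v ⊎ (∃ λ a → Lower a × v ≡ raise a) → v ∈ elems M
  ∈-elems-M (inj₁ lv) = there (there (proj₁ (∈-elems-graph⁺ raise lowers (∈-lowers⁺ lv))))
  ∈-elems-M (inj₂ (a , la , refl)) =
    there (there (proj₂ (∈-elems-graph⁺ raise lowers (∈-lowers⁺ la))))

  graph-onto-toggled : ∀ {y : Pre n k} → y ∈ elems (graph raise lowers) →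
                       Onto y × toggle₀ y ≢ nothing
  graph-onto-toggled y∈ with ∈-elems-graph⁻ raise lowers y∈
  ... | a , a∈ , inj₁ refl = Lower.onto la ,
          λ t → contradiction (trans (sym t) (Lower.toggled la)) λ ()
    where la = ∈-lowers⁻ a∈
  ... | a , a∈ , inj₂ refl = raise-onto la ,
          λ t → contradiction (trans (sym t) (trans (toggle₀-raise la) (Lower.toggled la))) λ ()
    where la = ∈-lowers⁻ a∈

  empty≢vertex : empty n ≢ vertex
  empty≢vertex eq = empty-not-onto (subst Onto (sym eq) vertex-onto)

  unique-elems : Unique (elems M)
  unique-elems =
    (empty≢vertex ∷ All.tabulate empty∉) ∷ All.tabulate vertex∉ ∷
    unique-elems-graph raise lowers (Unique.filter⁺ lower? (deduplicate-! _≟ₚ_ (allPre n k)))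
      (λ a∈ b∈ → lower≢raise (∈-lowers⁻ a∈) (∈-lowers⁻ b∈))
      (λ a∈ b∈ → raise-injective (∈-lowers⁻ a∈) (∈-lowers⁻ b∈))
    where
    empty∉ : ∀ {y} → y ∈ elems (graph raise lowers) → empty n ≢ y
    empty∉ y∈ eq = empty-not-onto (subst Onto (sym eq) (proj₁ (graph-onto-toggled y∈)))
    vertex∉ : ∀ {y} → y ∈ elems (graph raise lowers) → vertex ≢ y
    vertex∉ y∈ eq =
      proj₂ (graph-onto-toggled y∈) (trans (cong toggle₀ (sym eq)) (toggle-diagonalFrom 0 n))

  face⇒ : ∀ {a : Pre n k} → IsFace a → Onto a ⊎ a ≡ empty n
  face⇒ (inj₁ surj) = inj₁ λ j → lookup⇒∈ᵢ _ _ (proj₂ (surj j))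
  face⇒ (inj₂ none) = inj₂ (lookup-nothing⇒empty _ none)

  onto⇒face : ∀ {a : Pre n k} → Onto a → IsFace a
  onto⇒face onto = inj₁ (∈ᵢ⇒lookup ∘ onto)

  empty⪯ : ∀ (a : Pre n k) → empty n ⪯ a
  empty⪯ a i j eq = contradiction (trans (sym (lookup-replicate i nothing)) eq) λ ()

  empty⋖vertex : empty n ⋖ vertex
  empty⋖vertex = (empty⪯ vertex , empty≢vertex) ,
    λ { (c , c-face , (_ , ∅≢c) , c⪯δ , c≢δ) → case face⇒ {c} c-face of λ where
          (inj₁ onto) → c≢δ (⊑-diagonalFrom⇒≡ 0 n c (⪯⇒⊑ c⪯δ) (covers₀ onto))
          (inj₂ c≡∅)  → ∅≢c (sym c≡∅) }

  lower⋖raise : ∀ {a} → Lower a → a ⋖ raise a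
  lower⋖raise {a} la@(lower _ i e t l) = (⊑⇒⪯ (⊑-raise la) , lower≢raise la la) ,
    λ { (c , _ , (a⪯c , a≢c) , c⪯ra , c≢ra) →
          case ⊑-insert-interval a c i e l (⪯⇒⊑ a⪯c) (subst (c ⊑_) (raise-≡ a t) (⪯⇒⊑ c⪯ra))
          of λ where
            (inj₁ c≡a)  → a≢c (sym c≡a)
            (inj₂ c≡a⁺) → c≢ra (trans c≡a⁺ (sym (raise-≡ a t))) }

  matched-covers : ∀ {a b} → Matched a b → IsFace a × IsFace b × a ⋖ b
  matched-covers empty-vertex =
    inj₂ (λ i → lookup-replicate i nothing) , onto⇒face vertex-onto , empty⋖vertex
  matched-covers (lower-raise la) =
    onto⇒face (Lower.onto la) , onto⇒face (raise-onto la) , lower⋖raise la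

  isMatching : IsMatching M
  isMatching = unique-elems , λ i → matched-covers (∈-M⁻ (∈-lookup i))

  potential : Pre n k → ℕ
  potential a = size a * 3 ^ n + lexRank (diagonal 0) a

  potential-size< : ∀ {u v : Pre n k} → size u < size v → potential u < potential v
  potential-size< {u} = leading-digit-< (lexRank<3^ (diagonal 0) u)

  potential-facet< : ∀ {a u : Pre n k} → Lower a → Onto u → u ⊑ raise a → u ≢ raise a → u ≢ a →
                     potential u < potential a
  potential-facet< {a} {u} (lower _ i e t l) onto u⊑ra u≢ra u≢a with ℕ.<-cmp (size u) (size a)
  ... | tri< u<a _ _ = potential-size< {u} {a} u<a
  ... | tri≈ _ u≡a _ = subst (λ s → s * 3 ^ n + lexRank (diagonal 0) u < potential a) (sym u≡a)
    (ℕ.+-monoʳ-< (size a * 3 ^ n)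
      (lexRank-facet< (diagonal 0) u a i e t l (covers₀ onto) u⊑a⁺ u≡a u≢a))
    where
    u⊑a⁺ : u ⊑ a [ i ]≔ just e
    u⊑a⁺ = subst (u ⊑_) (raise-≡ a t) u⊑ra
  ... | tri> _ _ a<u = contradiction (trans (⊑-size-≡ (subst (u ⊑_) (raise-≡ a t) u⊑ra)
                                     (ℕ.≤-trans (ℕ.≤-reflexive (size-insert a i e l)) a<u))
                                   (sym (raise-≡ a t))) u≢ra

  potential-decreases : ∀ {a b a′ b′} → Matched a b → Matched a′ b′ → a′ ≢ a → a′ ≺ b →
                        potential a′ < potential a
  potential-decreases empty-vertex empty-vertex a′≢a _ = contradiction refl a′≢a
  potential-decreases empty-vertex (lower-raise la′) _ (a′⪯δ , a′≢δ) =
    contradiction (⊑-diagonalFrom⇒≡ 0 n _ (⪯⇒⊑ a′⪯δ) (covers₀ (Lower.onto la′))) a′≢δ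
  potential-decreases {a} (lower-raise la) empty-vertex _ _ =
    potential-size< {empty n} {a}
      (subst (_< size a) (sym (size-empty n)) (∈ᵢ⇒size>0 (Lower.onto la j₀)))
  potential-decreases (lower-raise la) (lower-raise la′) a′≢a (a′⪯ra , a′≢ra) =
    potential-facet< la (Lower.onto la′) (⪯⇒⊑ a′⪯ra) a′≢ra a′≢a

  toggled⇒matched : ∀ {v : Pre n k} {i e} → Onto v → toggle₀ v ≡ just (i , e) →
                    Lower v ⊎ (∃ λ a → Lower a × v ≡ raise a)
  toggled⇒matched {v} {i} {e} onto t with toggle-entry (diagonal 0) v t
  ... | inj₁ l = inj₁ (lower onto i e t l)
  ... | inj₂ l = inj₂ (a , lower onto-a i e t-a (lookup∘update i v nothing) ,
                       sym (trans (raise-≡ a t-a) ([]≔-revert v i l)))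
    where
    a : Pre n k
    a = v [ i ]≔ nothing
    t-a : toggle₀ a ≡ just (i , e)
    t-a = toggle-delete (diagonal 0) v i e t l
    onto-a : Onto a
    onto-a j with ∈-[]≔⁺ v i (onto j)
    ... | inj₁ j∈a = j∈a
    ... | inj₂ lj with trans (sym l) lj
    ...   | refl with toggle-delete-keeps (diagonal 0) v i e t l
    ...     | inj₁ e∈a = e∈a

  critical-dim : ∀ v → IsCritical M v → dim v ≡ + (n ∸ k)
  critical-dim v (face , v∉M) with face⇒ {v} face
  ... | inj₂ refl = contradiction (here refl) v∉M
  ... | inj₁ onto with toggle₀ v in t
  ...   | just _  = contradiction (∈-elems-M (toggled⇒matched onto t)) v∉M
  ...   | nothing with untoggled-diagonal 0 n v t (λ _ ())
  ...     | inj₁ full = dim-full v full (ℕ.≤-<-trans z≤n k<n) (ℕ.<⇒≤ k<n)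
  ...     | inj₂ refl = contradiction (there (here refl)) v∉M

lemma3p2 : (n k : ℕ) → 1 ≤ k → k < n →
    Σ (Matching n k) λ M → IsMatching M × IsAcyclic M ×
    (∀ (v : Pre n k) → IsCritical M v → dim v ≡ + (n ∸ k))
lemma3p2 n k 1≤k k<n =
  M , isMatching ,
  acyclic-by-potential M (proj₁ isMatching) potential
    (λ p∈ q∈ → potential-decreases (∈-M⁻ p∈) (∈-M⁻ q∈)) ,
  critical-dim
  where open Construction n k 1≤k k<n
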